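{- Let $R$ be the graph with vertex set $\{a,b,c,d\}$ and all edges except $ac$. Let $\mathcal{H}=(L,H)$ be a correspondence cover of $R$ in which every matching $M_e$, $e\in E(R)$, is maximal, with $|L(a)|=1$ and $|L(b)|=|L(c)|=|L(d)|=2$. Write $L(c)=\{c_1,c_2\}$ and suppose that the cover $\mathcal{H}\setminus\{c_2\}$ (obtained by deleting the color $c_2$) is twisted. Then $\mathcal{H}\setminus\{c_1\}$ is not wedged; furthermore, there is a $0$-defective $\mathcal{H}$-coloring $\phi$ of $R$ with $\phi(c)=c_2$.
   Context: A correspondence cover of a graph $G$ is a pair $\mathcal{H}=(L,H)$ with $H$ a graph and $L:V(G)\to 2^{V(H)}$ such that $\{L(v)\}$ partitions $V(H)$, each $L(v)$ is independent in $H$, and for all $u,v$ the edges of $H$ between $L(u)$ and $L(v)$ form a matching, empty if $uv\notin E(G)$. An $\mathcal{H}$-coloring is a map $\phi$ with $\phi(w)\in L(w)$; it is $0$-defective if no two adjacent vertices receive colors adjacent in $H$. $\mathcal{H}\setminus\{c_i\}$ denotes the cover obtained by removing $c_i$ from $H$ and from $L(c)$. For a cover of $R$ with $|L(a)|=|L(c)|=1$, $|L(b)|=|L(d)|=2$: it is twisted if the colors can be labeled $L(a)=\{a_1\}$, $L(b)=\{b_1,b_2\}$, $L(c)=\{c_1\}$, $L(d)=\{d_1,d_2\}$ so that $a_1b_1d_2c_1b_2d_1a_1$ is a cycle in $H$; it is wedged if the colors can be so labeled that $a_1b_1$ and $a_1d_1$ are edges and at least two of $b_2d_2$, $c_1b_2$,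 $c_1d_2$ are edges of $H$. -}

module Defs where

open import Data.Bool using (Bool; true; false)
open import Data.Product using (Σ; ∃; ∃-syntax; _×_; _,_)
open import Data.Sum using (_⊎_)
open import Relation.Binary.PropositionalEquality using (_≡_; _≢_)
open import Relation.Nullary using (¬_)

data V : Set where
  a b c d : V

RAdj : V → V → Bool
RAdj a a = false
RAdj a b = true
RAdj a c = false
RAdj a d = true
RAdj b a = true
RAdj b b = false
RAdj b c = true
RAdj b d = true
RAdj c a = false
RAdj c b = true
RAdj c c = false
RAdj c d = true
RAdj d a = true
RAdj d b = true
RAdj d c = true
RAdj d d = false

-- Raw cover data of a graph with vertex type W: a set of colours C
-- (the vertices of H), the map col assigning each colour to the vertex
-- whose list contains it (so L(v) = { x | col x ≡ v }, and the lists
-- partition V(H) automatically), and the (decidable) adjacency of H.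

record PreCover (W : Set) : Set₁ where
  field
    C   : Set
    col : C → W
    adj : C → C → Bool
open PreCover public

_∈L_ : ∀ {W} {P : PreCover W} → C P → W → Set
_∈L_ {P = P} x v = col P x ≡ v

record IsCover {W : Set} (GA : W → W → Bool) (P : PreCover W) : Set where
  field
    symm        : ∀ x y → adj P x y ≡ adj P y x
    independent : ∀ x y → col P x ≡ col P y → adj P x y ≡ false
    -- edges between L(u) and L(v) form a matching
    -- (each colour has at most one neighbour in each list; with symmetry
    --  this is exactly a matching)
    matching    : ∀ x y y' → adj P x y ≡ true → adj P x y' ≡ true →
                  col P y ≡ col P y' → y ≡ y'
    nonEdge     : ∀ x y → adj P x y ≡ true → GA (col P x) (col P y) ≡ true

-- The matching M_{uv} (edges of H between L(u) and L(v)) is maximal: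
-- no edge of the complete bipartite graph between L(u) and L(v) can be
-- added, i.e. for every x ∈ L(u), y ∈ L(v), x or y is already matched.
MaximalMatching : ∀ {W} (P : PreCover W) → W → W → Set
MaximalMatching P u v =
  ∀ x y → col P x ≡ u → col P y ≡ v →
    (∃[ y' ] (col P y' ≡ v × adj P x y' ≡ true)) ⊎
    (∃[ x' ] (col P x' ≡ u × adj P x' y ≡ true))

IsSingleton : ∀ {W} (P : PreCover W) → W → C P → Set
IsSingleton P v x1 = col P x1 ≡ v × (∀ x → col P x ≡ v → x ≡ x1)

IsPair : ∀ {W} (P : PreCover W) → W → C P → C P → Set
IsPair P v x1 x2 =
  x1 ≢ x2 × col P x1 ≡ v × col P x2 ≡ v ×
  (∀ x → col P x ≡ v → (x ≡ x1 ⊎ x ≡ x2))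

HasSize1 : ∀ {W} (P : PreCover W) → W → Set
HasSize1 P v = ∃[ x1 ] IsSingleton P v x1

HasSize2 : ∀ {W} (P : PreCover W) → W → Set
HasSize2 P v = ∃[ x1 ] ∃[ x2 ] IsPair P v x1 x2

-- Deleting a colour z: H \ {z}.  The new colour set is the subset of
-- colours different from z (proof field irrelevant, so elements are
-- equal iff their underlying colours are).

record Without {A : Set} (z : A) : Set where
  constructor _,,_
  field
    val : A
    .fresh : val ≢ z
open Without public

delete : ∀ {W} (P : PreCover W) → C P → PreCover W
delete P z = record
  { C   = Without z
  ; col = λ x → col P (val x)
  ; adj = λ x y → adj P (val x) (val y)
  }

Twisted : PreCover V → Set
Twisted P =
  ∃[ a1 ] ∃[ b1 ] ∃[ b2 ] ∃[ c1 ] ∃[ d1 ] ∃[ d2 ]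
    ( IsSingleton P a a1 × IsPair P b b1 b2 ×
      IsSingleton P c c1 × IsPair P d d1 d2 ×
      adj P a1 b1 ≡ true × adj P b1 d2 ≡ true × adj P d2 c1 ≡ true ×
      adj P c1 b2 ≡ true × adj P b2 d1 ≡ true × adj P d1 a1 ≡ true )

Wedged : PreCover V → Set
Wedged P =
  ∃[ a1 ] ∃[ b1 ] ∃[ b2 ] ∃[ c1 ] ∃[ d1 ] ∃[ d2 ]
    ( IsSingleton P a a1 × IsPair P b b1 b2 ×
      IsSingleton P c c1 × IsPair P d d1 d2 ×
      adj P a1 b1 ≡ true × adj P a1 d1 ≡ true ×
      ( (adj P b2 d2 ≡ true × adj P c1 b2 ≡ true) ⊎
        (adj P b2 d2 ≡ true × adj P c1 d2 ≡ true) ⊎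
        (adj P c1 b2 ≡ true × adj P c1 d2 ≡ true) ) )

IsColoring : ∀ {W} (P : PreCover W) → (W → C P) → Set
IsColoring {W} P φ = ∀ (v : W) → col P (φ v) ≡ v

ZeroDefective : ∀ {W} (GA : W → W → Bool) (P : PreCover W) → (W → C P) → Set
ZeroDefective GA P φ =
  ∀ u v → GA u v ≡ true → adj P (φ u) (φ v) ≡ false

-- Deleting c₂ leaves the six-cycle a₁b₁d₂c₁b₂d₁, so c₁ is matched to b₂ and d₂.
-- Maximality of the matchings between the two-element lists L(c) and L(b),
-- resp. L(c) and L(d), then forces c₂b₁ and c₂d₁ to be edges. Every colour of
-- a₁, b₂, c₂, d₂ has its partner in each neighbouring list among a₁, b₁, c₁, d₁,
-- so these four colours are pairwise non-adjacent, which gives the colouring.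
-- In H ∖ {c₁} the only candidates for the edges b₂d₂, c₁b₂, c₁d₂ of a wedge are
-- b₂d₂, c₂b₂, c₂d₂, and none of them is an edge.
module Submission where

open import Defs
open import Data.Bool using (Bool; true; false)
open import Data.Empty using (⊥-elim)
import Data.Empty.Irrelevant as Irrelevant
open import Data.Product using (∃-syntax; _×_; _,_; proj₁; proj₂)
open import Data.Sum using (_⊎_; inj₁; inj₂; [_,_]′)
open import Function using (_∘_)
open import Relation.Binary.PropositionalEquality
  using (_≡_; _≢_; refl; sym; trans; cong; subst; subst₂)
open import Relation.Nullary using (¬_)

val-fresh : ∀ {A : Set} {z : A} (x : Without z) → val x ≢ z
val-fresh (_ ,, fresh) eq = Irrelevant.⊥-elim (fresh eq)

val-injective : ∀ {A : Set} {z : A} {x y : Without z} → val x ≡ val y → x ≡ y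
val-injective {x = _ ,, _} {y = _ ,, _} refl = refl

false⇒¬true : ∀ {x : Bool} → x ≡ false → ¬ x ≡ true
false⇒¬true refl ()

module CoverLists {W : Set} (P : PreCover W) where

  IsPair-distinct : ∀ {v p q} → IsPair P v p q → p ≢ q
  IsPair-distinct (p≢q , _) = p≢q

  IsPair-col₁ : ∀ {v p q} → IsPair P v p q → col P p ≡ v
  IsPair-col₁ (_ , cp , _) = cp

  IsPair-col₂ : ∀ {v p q} → IsPair P v p q → col P q ≡ v
  IsPair-col₂ (_ , _ , cq , _) = cq

  IsPair-sameList : ∀ {v p q} → IsPair P v p q → col P p ≡ col P q
  IsPair-sameList pq = trans (IsPair-col₁ pq) (sym (IsPair-col₂ pq))

  IsPair-sym : ∀ {v p q} → IsPair P v p q → IsPair P v q p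
  IsPair-sym (p≢q , cp , cq , all) =
    (λ eq → p≢q (sym eq)) , cq , cp , λ x cx → swap (all x cx)
    where
    swap : ∀ {A B : Set} → A ⊎ B → B ⊎ A
    swap (inj₁ x) = inj₂ x
    swap (inj₂ y) = inj₁ y

  IsPair-other : ∀ {v p q x} → IsPair P v p q → col P x ≡ v → x ≢ q → x ≡ p
  IsPair-other (_ , _ , _ , all) cx x≢q with all _ cx
  ... | inj₁ x≡p = x≡p
  ... | inj₂ x≡q = ⊥-elim (x≢q x≡q)

  IsPair-partner : ∀ {v p q x y} → IsPair P v p q → IsPair P v x y → x ≡ p → y ≡ q
  IsPair-partner pq (x≢y , _ , cy , _) refl =
    IsPair-other (IsPair-sym pq) cy (λ y≡p → x≢y (sym y≡p))

  module _ {z : C P} {v : W} (z∉L : col P z ≢ v) where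

    private
      keep : ∀ x → col P x ≡ v → Without z
      keep x cx = x ,, λ x≡z → z∉L (trans (cong (col P) (sym x≡z)) cx)

    IsSingleton-delete : ∀ {x} → IsSingleton (delete P z) v x → IsSingleton P v (val x)
    IsSingleton-delete (cx , all) = cx , λ y cy → cong val (all (keep y cy) cy)

    IsPair-delete : ∀ {x y} → IsPair (delete P z) v x y → IsPair P v (val x) (val y)
    IsPair-delete (x≢y , cx , cy , all) =
      (λ eq → x≢y (val-injective eq)) , cx , cy , λ w cw → lift (all (keep w cw) cw)
      where
      lift : ∀ {w x y : Without z} → w ≡ x ⊎ w ≡ y → val w ≡ val x ⊎ val w ≡ val y
      lift (inj₁ eq) = inj₁ (cong val eq)
      lift (inj₂ eq) = inj₂ (cong val eq)

  module _ {GA : W → W → Bool} (cov : IsCover GA P) where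
    open IsCover cov

    matched⇒non-adj : ∀ {x y y'} → adj P x y ≡ true → col P y ≡ col P y' → y ≢ y' →
                      adj P x y' ≡ false
    matched⇒non-adj {x} {y} {y'} xy cy≡cy' y≢y' with adj P x y' in xy'
    ... | false = refl
    ... | true = ⊥-elim (y≢y' (matching x y y' xy xy' cy≡cy'))

    non-adj-sym : ∀ {x y} → adj P x y ≡ false → adj P y x ≡ false
    non-adj-sym {x} {y} xy = trans (symm y x) xy

    -- A maximal matching between two 2-element lists is empty or perfect.
    maximal-pair-edge : ∀ {u v u₁ u₂ v₁ v₂} → IsPair P u u₁ u₂ → IsPair P v v₁ v₂ →
                        MaximalMatching P u v → adj P u₁ v₂ ≡ true → adj P u₂ v₁ ≡ true
    maximal-pair-edge {u₁ = u₁} {u₂} {v₁} {v₂} U V maximal u₁v₂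
      with maximal u₂ v₁ (IsPair-col₂ U) (IsPair-col₁ V)
    ... | inj₁ (y , cy , u₂y) = subst (λ y → adj P u₂ y ≡ true) (IsPair-other V cy y≢v₂) u₂y
      where
      y≢v₂ : y ≢ v₂
      y≢v₂ refl = IsPair-distinct U (matching v₂ u₁ u₂
        (trans (symm v₂ u₁) u₁v₂) (trans (symm v₂ u₂) u₂y) (IsPair-sameList U))
    ... | inj₂ (x , cx , xv₁) =
      subst (λ x → adj P x v₁ ≡ true) (IsPair-other (IsPair-sym U) cx x≢u₁) xv₁
      where
      x≢u₁ : x ≢ u₁
      x≢u₁ refl = IsPair-distinct V (matching u₁ v₁ v₂ xv₁ u₁v₂ (IsPair-sameList V))

record TwistedConfiguration (P : PreCover V) (c₁ : C P) : Set where
  field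
    a₁ b₁ b₂ d₁ d₂ : C P
    a-singleton : IsSingleton P a a₁
    b-pair      : IsPair P b b₁ b₂
    d-pair      : IsPair P d d₁ d₂
    a₁b₁ : adj P a₁ b₁ ≡ true
    b₁d₂ : adj P b₁ d₂ ≡ true
    d₂c₁ : adj P d₂ c₁ ≡ true
    c₁b₂ : adj P c₁ b₂ ≡ true
    b₂d₁ : adj P b₂ d₁ ≡ true
    d₁a₁ : adj P d₁ a₁ ≡ true

module _ {P : PreCover V} {c₁ c₂ : C P} (c-pair : IsPair P c c₁ c₂) where
  open CoverLists P

  private
    c₁∉L : ∀ {v} → v ≢ c → col P c₁ ≢ v
    c₁∉L v≢c cc₁≡v = v≢c (trans (sym cc₁≡v) (IsPair-col₁ c-pair))

    c₂∉L : ∀ {v} → v ≢ c → col P c₂ ≢ v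
    c₂∉L v≢c cc₂≡v = v≢c (trans (sym cc₂≡v) (IsPair-col₂ c-pair))

  twisted-delete : Twisted (delete P c₂) → TwistedConfiguration P c₁
  twisted-delete (a₁ , b₁ , b₂ , k , d₁ , d₂ , A , B , (ck , _) , D ,
                  a₁b₁ , b₁d₂ , d₂k , kb₂ , b₂d₁ , d₁a₁) = record
    { a₁ = val a₁ ; b₁ = val b₁ ; b₂ = val b₂ ; d₁ = val d₁ ; d₂ = val d₂
    ; a-singleton = IsSingleton-delete (c₂∉L λ ()) A
    ; b-pair = IsPair-delete (c₂∉L λ ()) B
    ; d-pair = IsPair-delete (c₂∉L λ ()) D
    ; a₁b₁ = a₁b₁ ; b₁d₂ = b₁d₂
    ; d₂c₁ = subst (λ x → adj P (val d₂) x ≡ true) k≡c₁ d₂k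
    ; c₁b₂ = subst (λ x → adj P x (val b₂) ≡ true) k≡c₁ kb₂
    ; b₂d₁ = b₂d₁ ; d₁a₁ = d₁a₁
    }
    where
    k≡c₁ : val k ≡ c₁
    k≡c₁ = IsPair-other c-pair ck (val-fresh k)

  module FromTwisted (cov : IsCover RAdj P)
                     (maximal : ∀ u v → RAdj u v ≡ true → MaximalMatching P u v)
                     (T : TwistedConfiguration P c₁) where
    open IsCover cov
    open TwistedConfiguration T

    c₂b₁ : adj P c₂ b₁ ≡ true
    c₂b₁ = maximal-pair-edge cov c-pair b-pair (maximal c b refl) c₁b₂

    c₂d₁ : adj P c₂ d₁ ≡ true
    c₂d₁ = maximal-pair-edge cov c-pair d-pair (maximal c d refl) (trans (symm c₁ d₂) d₂c₁)

    a₁b₂ : adj P a₁ b₂ ≡ false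
    a₁b₂ = matched⇒non-adj cov a₁b₁ (IsPair-sameList b-pair) (IsPair-distinct b-pair)

    a₁d₂ : adj P a₁ d₂ ≡ false
    a₁d₂ = matched⇒non-adj cov (trans (symm a₁ d₁) d₁a₁)
             (IsPair-sameList d-pair) (IsPair-distinct d-pair)

    b₂c₂ : adj P b₂ c₂ ≡ false
    b₂c₂ = matched⇒non-adj cov (trans (symm b₂ c₁) c₁b₂)
             (IsPair-sameList c-pair) (IsPair-distinct c-pair)

    b₂d₂ : adj P b₂ d₂ ≡ false
    b₂d₂ = matched⇒non-adj cov b₂d₁ (IsPair-sameList d-pair) (IsPair-distinct d-pair)

    c₂d₂ : adj P c₂ d₂ ≡ false
    c₂d₂ = matched⇒non-adj cov c₂d₁ (IsPair-sameList d-pair) (IsPair-distinct d-pair)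

    coloring : V → C P
    coloring a = a₁
    coloring b = b₂
    coloring c = c₂
    coloring d = d₂

    coloring-IsColoring : IsColoring P coloring
    coloring-IsColoring a = proj₁ a-singleton
    coloring-IsColoring b = IsPair-col₂ b-pair
    coloring-IsColoring c = IsPair-col₂ c-pair
    coloring-IsColoring d = IsPair-col₂ d-pair

    coloring-zeroDefective : ZeroDefective RAdj P coloring
    coloring-zeroDefective a b _ = a₁b₂
    coloring-zeroDefective a d _ = a₁d₂
    coloring-zeroDefective b c _ = b₂c₂
    coloring-zeroDefective b d _ = b₂d₂
    coloring-zeroDefective c d _ = c₂d₂
    coloring-zeroDefective b a _ = non-adj-sym cov a₁b₂
    coloring-zeroDefective d a _ = non-adj-sym cov a₁d₂
    coloring-zeroDefective c b _ = non-adj-sym cov b₂c₂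
    coloring-zeroDefective d b _ = non-adj-sym cov b₂d₂
    coloring-zeroDefective d c _ = non-adj-sym cov c₂d₂

    ¬wedged : ¬ Wedged (delete P c₁)
    ¬wedged (w₁ , x₁ , x₂ , y₁ , z₁ , z₂ , (cw₁ , _) , X , (cy₁ , _) , Z ,
             w₁x₁ , w₁z₁ , two-edges) =
      [ ¬x₂z₂ ∘ proj₁ , [ ¬x₂z₂ ∘ proj₁ , ¬y₁x₂ ∘ proj₁ ]′ ]′ two-edges
      where
      w₁≡a₁ : val w₁ ≡ a₁
      w₁≡a₁ = proj₂ a-singleton (val w₁) cw₁

      -- a₁ is matched to b₁ and to d₁, so the wedge labels them x₁ and z₁.
      x₂≡b₂ : val x₂ ≡ b₂
      x₂≡b₂ = IsPair-partner b-pair X'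
        (sym (matching a₁ b₁ (val x₁) a₁b₁
                (subst (λ w → adj P w (val x₁) ≡ true) w₁≡a₁ w₁x₁)
                (trans (IsPair-col₁ b-pair) (sym (IsPair-col₁ X')))))
        where X' = IsPair-delete (c₁∉L λ ()) X

      z₂≡d₂ : val z₂ ≡ d₂
      z₂≡d₂ = IsPair-partner d-pair Z'
        (sym (matching a₁ d₁ (val z₁) (trans (symm a₁ d₁) d₁a₁)
                (subst (λ w → adj P w (val z₁) ≡ true) w₁≡a₁ w₁z₁)
                (trans (IsPair-col₁ d-pair) (sym (IsPair-col₁ Z')))))
        where Z' = IsPair-delete (c₁∉L λ ()) Z

      y₁≡c₂ : val y₁ ≡ c₂
      y₁≡c₂ = IsPair-other (IsPair-sym c-pair) cy₁ (val-fresh y₁)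

      ¬x₂z₂ : ¬ adj P (val x₂) (val z₂) ≡ true
      ¬x₂z₂ = false⇒¬true
        (subst₂ (λ x z → adj P x z ≡ false) (sym x₂≡b₂) (sym z₂≡d₂) b₂d₂)

      ¬y₁x₂ : ¬ adj P (val y₁) (val x₂) ≡ true
      ¬y₁x₂ = false⇒¬true
        (subst₂ (λ y x → adj P y x ≡ false) (sym y₁≡c₂) (sym x₂≡b₂) (non-adj-sym cov b₂c₂))

lemma5p5 : (P : PreCover V) → IsCover RAdj P →
    (∀ u v → RAdj u v ≡ true → MaximalMatching P u v) →
    HasSize1 P a → HasSize2 P b → HasSize2 P d →
    (c1 c2 : C P) → IsPair P c c1 c2 →
    Twisted (delete P c2) →
    ¬ Wedged (delete P c1) ×
    (∃[ φ ] (IsColoring P φ × ZeroDefective RAdj P φ × φ c ≡ c2))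
lemma5p5 P cov maximal _ _ _ c1 c2 c-pair twisted =
  ¬wedged , coloring , coloring-IsColoring , coloring-zeroDefective , refl
  where
  open FromTwisted c-pair cov maximal (twisted-delete c-pair twisted)
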